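{- Let $G$ be a finite simple undirected graph with $m$ edges, let $k\in\mathbb{N}$, suppose $G$ is $k$-edge-connected, and let $c_k$ be the minimum number of edges of a spanning $k$-edge-connected subgraph of $G$; assume $c_k<m$. Then the number of $k$-arc-strong orientations of $G$ is at most $\left(\frac{m\,\mathrm{e}}{m-c_k}\right)^{m-c_k}$.
   Context: A graph is $k$-edge-connected if it remains connected whenever fewer than $k$ edges are removed. An orientation of $G$ assigns a direction to each edge; it is $k$-arc-strong if the resulting digraph has, for every pair of vertices $u,v$, $k$ arc-disjoint directed paths from $u$ to $v$. $\mathrm{e}$ is Euler's number. -}

module Defs where

open import Data.Nat using (ℕ; zero; suc; _+_; _*_; _∸_; _^_; _≤_; _<_)
open import Data.Fin using (Fin)
open import Data.Bool using (Bool; true; false; if_then_else_)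
open import Data.Product using (Σ; ∃; _×_; _,_; proj₁; proj₂)
open import Data.Sum using (_⊎_)
open import Data.List using (List; []; _∷_; length)
open import Data.List.Membership.Propositional using (_∈_; _∉_)
open import Data.List.Relation.Unary.All using (All)
open import Data.Vec using (Vec; lookup)
import Data.List.Relation.Unary.Unique.Propositional as UniqueP
open import Relation.Binary.PropositionalEquality using (_≡_; _≢_)

record Graph : Set where
  field
    n      : ℕ
    m      : ℕ
    ends   : Fin m → Fin n × Fin n
    noLoop : ∀ e → proj₁ (ends e) ≢ proj₂ (ends e)
    noPar  : ∀ e f → (ends e ≡ ends f ⊎
                      (proj₁ (ends e) ≡ proj₂ (ends f) × proj₂ (ends e) ≡ proj₁ (ends f)))
                   → e ≡ f
open Graph public

module _ (G : Graph) where

  Joins : Fin (m G) → Fin (n G) → Fin (n G) → Set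
  Joins e u w = ends G e ≡ (u , w) ⊎ ends G e ≡ (w , u)

  data Walk (E : Fin (m G) → Set) : Fin (n G) → Fin (n G) → Set where
    here : ∀ {u} → Walk E u u
    step : ∀ {u w v} (e : Fin (m G)) → E e → Joins e u w → Walk E w v → Walk E u v

  Connected : (Fin (m G) → Set) → Set
  Connected E = ∀ u v → Walk E u v

  KEdgeConnectedSub : ℕ → (Fin (m G) → Bool) → Set
  KEdgeConnectedSub k A =
    ∀ (F : List (Fin (m G))) → length F < k →
      Connected (λ e → (A e ≡ true) × (e ∉ F))

  KEdgeConnected : ℕ → Set
  KEdgeConnected k = KEdgeConnectedSub k (λ _ → true)

  count : ∀ {j} → (Fin j → Bool) → ℕ
  count {zero}  A = 0
  count {suc j} A = (if A Fin.zero then 1 else 0) + count (λ i → A (Fin.suc i))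

  IsMinKECSize : ℕ → ℕ → Set
  IsMinKECSize k c =
    (Σ (Fin (m G) → Bool) λ A → KEdgeConnectedSub k A × count A ≡ c) ×
    (∀ (A : Fin (m G) → Bool) → KEdgeConnectedSub k A → c ≤ count A)

  -- Orientations: lookup o e = true orients e from proj₁ (ends e) to
  -- proj₂ (ends e); false orients it the other way.
  Orientation : Set
  Orientation = Vec Bool (m G)

  tail head : Orientation → Fin (m G) → Fin (n G)
  tail o e = if lookup o e then proj₁ (ends G e) else proj₂ (ends G e)
  head o e = if lookup o e then proj₂ (ends G e) else proj₁ (ends G e)

  data DWalk (o : Orientation) : Fin (n G) → Fin (n G) → Set where
    here : ∀ {u} → DWalk o u u
    step : ∀ {u v} (e : Fin (m G)) → tail o e ≡ u → DWalk o (head o e) v → DWalk o u v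

  arcs : ∀ {o u v} → DWalk o u v → List (Fin (m G))
  arcs here          = []
  arcs (step e _ p)  = e ∷ arcs p

  verts : ∀ {o u v} → DWalk o u v → List (Fin (n G))
  verts {u = u} here = u ∷ []
  verts {u = u} (step e _ p) = u ∷ verts p

  IsPath : ∀ {o u v} → DWalk o u v → Set
  IsPath p = UniqueP.Unique (verts p)

  ArcStrong : ℕ → Orientation → Set
  ArcStrong k o =
    ∀ u v → Σ (Fin k → DWalk o u v) λ P →
      (∀ i → IsPath (P i)) ×
      (∀ i j → i ≢ j → ∀ e → e ∈ arcs (P i) → e ∉ arcs (P j))

  -- "the number of k-arc-strong orientations is at most B":
  -- every duplicate-free list of k-arc-strong orientations has length ≤ B
  NumArcStrongSatisfies : ℕ → (ℕ → Set) → Set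
  NumArcStrongSatisfies k Bound =
    ∀ (L : List Orientation) → UniqueP.Unique L → All (ArcStrong k) L → Bound (length L)

-- N ≤ (M·e/d)^d, expressed with natural numbers only.
-- Since (1 + 1/t)^t increases to e, and (M e / d)^d is irrational for
-- d ≥ 1 (e^d is transcendental), N ≤ (M e/d)^d iff for some t,
-- N ≤ (M/d)^d (1+1/t)^(t d), i.e. N d^d t^(t d) ≤ M^d (t+1)^(t d).
-- (t = 0 gives N ≤ (M/d)^d, which also implies the bound.)
AtMostMeOverDPowD : ℕ → ℕ → ℕ → Set
AtMostMeOverDPowD M d N =
  ∃ λ t → N * d ^ d * t ^ (t * d) ≤ M ^ d * suc t ^ (t * d)

-- The Sauer–Shelah lemma bounds a family of N distinct 0/1-vectors of length m
-- that shatters no set of size ≥ d by N ≤ Σ_{i<d} C(m,i).  Orientations are 0/1-vectors indexed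
-- by edges, and the family of k-arc-strong orientations only shatters edge sets S whose
-- complement is k-edge-connected: given fewer than k edges F and vertices u, v, let X be the set of
-- vertices joined to v in the complement of S minus F, and orient S so that no arc enters X.  An
-- orientation of the family agreeing with this on S has k arc-disjoint u–v paths, one of which
-- avoids F, and following it back from v never leaves X, so u ∈ X.  Hence |S| ≤ m − c, and with
-- D = m − c the estimate Σ_{i≤D} C(m,i) ≤ (m/D)^D (1 + D/m)^m ≤ (m/D)^D (1 + 1/m)^(mD) gives the
-- bound, (1 + 1/m)^m being below e.

module Submission where

open import Defs
open import Data.Nat using (ℕ; zero; suc; _+_; _*_; _^_; _∸_; _≤_; _<_; z≤n; s≤s)
open import Data.Nat.Properties
  using ( +-comm; +-suc; *-comm; *-assoc; *-identityʳ; ^-*-assoc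
        ; ≤-refl; ≤-reflexive; ≤-trans; <-≤-trans; ≤-pred; <⇒≱; n≤1+n; m≤m+n; m≤n+m
        ; +-mono-≤; +-monoʳ-≤; *-mono-≤; *-monoˡ-≤; *-monoʳ-≤; ^-monoˡ-≤
        ; m<n⇒0<n∸m; m∸n≤m; m∸[m∸n]≡n; ∸-monoʳ-≤; module ≤-Reasoning )
open import Data.Nat.Tactic.RingSolver using (solve-∀)
open import Data.Bool using (Bool; true; false; not; _≟_)
open import Data.Fin using (Fin; zero; suc)
open import Data.Fin.Properties using (any?; pigeonhole; <⇒≢)
import Data.Fin.Properties as Fin
open import Data.Fin.Subset using (Subset; ∣_∣; ⊥; ⁅_⁆; ∁; _∩_; _∪_; _⊂_)
  renaming (_∈_ to _∈ₛ_; _∉_ to _∉ₛ_)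
open import Data.Fin.Subset.Properties
  using (∩-zeroˡ; p⊆p∪q; q⊆p∪q; x∈p∪q⁻; x∈⁅x⁆; x∈⁅y⁆⇒x≡y; p⊂q⇒∣p∣<∣q∣; ∣p∣≤n; ∣∁p∣≡n∸∣p∣)
  renaming (_∈?_ to _∈ₛ?_)
open import Data.Vec using ([]; _∷_; lookup; tabulate)
import Data.Vec.Properties as Vec
open import Data.List using (List; []; _∷_; length; _++_; filter)
import Data.List as List
open import Data.List.Properties using (length-++)
open import Data.List.Membership.Propositional using (_∈_; _∉_; find; lose)
open import Data.List.Membership.Propositional.Properties using (∈-++⁻; ∈-filter⁻)
import Data.List.Membership.DecPropositional as DecMembership
open import Data.List.Relation.Unary.Any as Any using (Any; here; there)
open import Data.List.Relation.Unary.Any.Properties using (lookup-index)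
open import Data.List.Relation.Unary.All as All using (All; []; _∷_)
open import Data.List.Relation.Unary.AllPairs using ([]; _∷_)
open import Data.List.Relation.Unary.Unique.Propositional using (Unique)
import Data.List.Relation.Unary.Unique.Propositional.Properties as Unique
open import Data.Product using (Σ-syntax; ∃-syntax; _×_; _,_; proj₁; proj₂)
open import Data.Sum using (_⊎_; inj₁; inj₂)
open import Data.Empty using (⊥-elim)
open import Function using (_∘_)
open import Relation.Nullary using (yes; no; ¬?; does)
open import Relation.Nullary.Decidable using (_×-dec_; _⊎-dec_)
open import Relation.Unary using (Decidable)
open import Relation.Binary using (DecidableEquality)
open import Relation.Binary.PropositionalEquality using (_≡_; _≢_; refl; cong; sym; trans; subst)

-- Ψ m d = Σ_{i<d} (m choose i), the number of subsets of size less than d of an m-set.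
Ψ : ℕ → ℕ → ℕ
Ψ m       zero    = 0
Ψ zero    (suc d) = 1
Ψ (suc m) (suc d) = Ψ m (suc d) + Ψ m d

^-distribʳ-* : ∀ a b m → (a * b) ^ m ≡ a ^ m * b ^ m
^-distribʳ-* a b zero    = refl
^-distribʳ-* a b (suc m) =
  trans (cong (a * b *_) (^-distribʳ-* a b m)) (interchange a b (a ^ m) (b ^ m))
  where
  interchange : ∀ a b x y → a * b * (x * y) ≡ a * x * (b * y)
  interchange = solve-∀

-- Σ_{i≤d} C(m,i) (p/q)^d ≤ Σ_i C(m,i) (p/q)^i = (1 + p/q)^m, with denominators cleared.
Ψ-weighted-≤ : ∀ {p q} → p ≤ q → ∀ m d → Ψ m (suc d) * p ^ d * q ^ m ≤ (p + q) ^ m * q ^ d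
Ψ-weighted-≤ {p} {q} p≤q zero d = begin
  1 * p ^ d * 1 ≡⟨ *-identityʳ (1 * p ^ d) ⟩
  1 * p ^ d     ≤⟨ *-monoʳ-≤ 1 (^-monoˡ-≤ d p≤q) ⟩
  1 * q ^ d     ∎
  where open ≤-Reasoning
Ψ-weighted-≤ {p} {q} p≤q (suc m) zero = begin
  (Ψ m 1 + 0) * 1 * (q * q ^ m)     ≡⟨ shuffle (Ψ m 1) q (q ^ m) ⟩
  q * (Ψ m 1 * 1 * q ^ m)           ≤⟨ *-mono-≤ (m≤n+m q p) (Ψ-weighted-≤ p≤q m zero) ⟩
  (p + q) * ((p + q) ^ m * 1)       ≡⟨ *-assoc (p + q) ((p + q) ^ m) 1 ⟨
  (p + q) * (p + q) ^ m * 1         ∎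
  where
  open ≤-Reasoning
  shuffle : ∀ a q Q → (a + 0) * 1 * (q * Q) ≡ q * (a * 1 * Q)
  shuffle = solve-∀
Ψ-weighted-≤ {p} {q} p≤q (suc m) (suc d) = begin
  (Ψ m (suc (suc d)) + Ψ m (suc d)) * (p * p ^ d) * (q * q ^ m)
    ≡⟨ split (Ψ m (suc (suc d))) (Ψ m (suc d)) p (p ^ d) q (q ^ m) ⟩
  q * (Ψ m (suc (suc d)) * (p * p ^ d) * q ^ m) + p * q * (Ψ m (suc d) * p ^ d * q ^ m)
    ≤⟨ +-mono-≤ (*-monoʳ-≤ q (Ψ-weighted-≤ p≤q m (suc d))) (*-monoʳ-≤ (p * q) (Ψ-weighted-≤ p≤q m d)) ⟩
  q * ((p + q) ^ m * (q * q ^ d)) + p * q * ((p + q) ^ m * q ^ d)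
    ≡⟨ merge p q ((p + q) ^ m) (q ^ d) ⟩
  (p + q) * (p + q) ^ m * (q * q ^ d)
    ∎
  where
  open ≤-Reasoning
  split : ∀ a b p P q Q → (a + b) * (p * P) * (q * Q) ≡ q * (a * (p * P) * Q) + p * q * (b * P * Q)
  split = solve-∀
  merge : ∀ p q R T → q * (R * (q * T)) + p * q * (R * T) ≡ (p + q) * R * (q * T)
  merge = solve-∀

-- 1 + (d+1)/m ≤ (1 + 1/m)^(d+1), with denominators cleared.
bernoulli : ∀ m d → (suc d + m) * m ^ d ≤ suc m ^ suc d
bernoulli m zero    = ≤-refl
bernoulli m (suc d) = begin
  (suc (suc d) + m) * (m * m ^ d)        ≡⟨ split m d (m ^ d) ⟩
  m * ((suc d + m) * m ^ d) + m ^ suc d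
    ≤⟨ +-mono-≤ (*-monoʳ-≤ m (bernoulli m d)) (^-monoˡ-≤ (suc d) (n≤1+n m)) ⟩
  m * suc m ^ suc d + suc m ^ suc d      ≡⟨ +-comm (m * suc m ^ suc d) (suc m ^ suc d) ⟩
  suc m * suc m ^ suc d                  ∎
  where
  open ≤-Reasoning
  split : ∀ m d P → (suc (suc d) + m) * (m * P) ≡ m * ((suc d + m) * P) + m * P
  split = solve-∀

Ψ-atMostMeOverDPowD : ∀ M D → 0 < D → D ≤ M → AtMostMeOverDPowD M D (Ψ M (suc D))
Ψ-atMostMeOverDPowD M D@(suc d) _ D≤M = M , (begin
  Ψ M (suc D) * D ^ D * M ^ (M * D)          ≡⟨ cong (Ψ M (suc D) * D ^ D *_) M^MD ⟩
  Ψ M (suc D) * D ^ D * (M ^ M * (M ^ d) ^ M) ≡⟨ *-assoc (Ψ M (suc D) * D ^ D) (M ^ M) ((M ^ d) ^ M) ⟨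
  Ψ M (suc D) * D ^ D * M ^ M * (M ^ d) ^ M  ≤⟨ *-monoˡ-≤ ((M ^ d) ^ M) (Ψ-weighted-≤ D≤M M D) ⟩
  (D + M) ^ M * M ^ D * (M ^ d) ^ M          ≡⟨ shuffle ((D + M) ^ M) (M ^ D) ((M ^ d) ^ M) ⟩
  M ^ D * ((D + M) ^ M * (M ^ d) ^ M)        ≡⟨ cong (M ^ D *_) (^-distribʳ-* (D + M) (M ^ d) M) ⟨
  M ^ D * ((D + M) * M ^ d) ^ M              ≤⟨ *-monoʳ-≤ (M ^ D) (^-monoˡ-≤ M (bernoulli M d)) ⟩
  M ^ D * (suc M ^ D) ^ M                    ≡⟨ cong (M ^ D *_) (^-*-assoc (suc M) D M) ⟩
  M ^ D * suc M ^ (D * M)                    ≡⟨ cong (λ e → M ^ D * suc M ^ e) (*-comm D M) ⟩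
  M ^ D * suc M ^ (M * D)                    ∎)
  where
  open ≤-Reasoning
  M^MD : M ^ (M * D) ≡ M ^ M * (M ^ d) ^ M
  M^MD = begin-equality
    M ^ (M * D)         ≡⟨ cong (M ^_) (*-comm M D) ⟩
    M ^ (D * M)         ≡⟨ ^-*-assoc M D M ⟨
    (M * M ^ d) ^ M     ≡⟨ ^-distribʳ-* M (M ^ d) M ⟩
    M ^ M * (M ^ d) ^ M ∎
  shuffle : ∀ a b c → a * b * c ≡ b * (a * c)
  shuffle = solve-∀

AtMostMeOverDPowD-antimono : ∀ {M D N N′} → N ≤ N′ →
                             AtMostMeOverDPowD M D N′ → AtMostMeOverDPowD M D N
AtMostMeOverDPowD-antimono {D = D} N≤N′ (t , bound) =
  t , ≤-trans (*-monoˡ-≤ (t ^ (t * D)) (*-monoˡ-≤ (D ^ D) N≤N′)) bound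

Shatters : ∀ {m} → List (Subset m) → Subset m → Set
Shatters F S = ∀ σ → ∃[ x ] x ∈ F × S ∩ x ≡ S ∩ σ

∩-agree-lookup : ∀ {m} {S x σ : Subset m} → S ∩ x ≡ S ∩ σ →
                 ∀ {i} → lookup S i ≡ true → lookup x i ≡ lookup σ i
∩-agree-lookup {S = true ∷ S} {_ ∷ x} {_ ∷ σ} eq {zero}  _   = Vec.∷-injectiveˡ eq
∩-agree-lookup {S = _ ∷ S}    {_ ∷ x} {_ ∷ σ} eq {suc i} i∈S = ∩-agree-lookup (Vec.∷-injectiveʳ eq) i∈S

length-filter-split : ∀ {A : Set} {P : A → Set} (P? : Decidable P) xs →
                      length xs ≡ length (filter P? xs) + length (filter (¬? ∘ P?) xs)
length-filter-split P? []       = refl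
length-filter-split P? (x ∷ xs) with P? x
... | yes _ = cong suc (length-filter-split P? xs)
... | no  _ = trans (cong suc (length-filter-split P? xs)) (sym (+-suc _ _))

withHead : ∀ {m} → Bool → List (Subset (suc m)) → List (Subset m)
withHead b []             = []
withHead b ((c ∷ x) ∷ F) with b ≟ c
... | yes _ = x ∷ withHead b F
... | no  _ = withHead b F

∈-withHead : ∀ {m} b (F : List (Subset (suc m))) {y} → y ∈ withHead b F → (b ∷ y) ∈ F
∈-withHead b ((c ∷ x) ∷ F) y∈ with b ≟ c
∈-withHead b ((c ∷ x) ∷ F) (here refl) | yes refl = here refl
∈-withHead b ((c ∷ x) ∷ F) (there y∈)  | yes _    = there (∈-withHead b F y∈)
... | no _ = there (∈-withHead b F y∈)

withHead-unique : ∀ {m} b (F : List (Subset (suc m))) → Unique F → Unique (withHead b F)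
withHead-unique b []             _             = []
withHead-unique b ((c ∷ x) ∷ F) (x∉F ∷ uniqF) with b ≟ c
... | yes refl = distinct b F x∉F ∷ withHead-unique b F uniqF
  where
  distinct : ∀ b F {y} → All ((b ∷ y) ≢_) F → All (y ≢_) (withHead b F)
  distinct b []             []         = []
  distinct b ((c ∷ x) ∷ F) (ne ∷ nes) with b ≟ c
  ... | yes refl = (ne ∘ cong (b ∷_)) ∷ distinct b F nes
  ... | no  _    = distinct b F nes
... | no  _    = withHead-unique b F uniqF

length-withHead : ∀ {m} (F : List (Subset (suc m))) →
                  length F ≡ length (withHead false F) + length (withHead true F)
length-withHead []                 = refl
length-withHead ((false ∷ x) ∷ F) = cong suc (length-withHead F)
length-withHead ((true ∷ x) ∷ F)  = trans (cong suc (length-withHead F)) (sym (+-suc _ _))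

sauerShelah : ∀ m d (F : List (Subset m)) → Unique F →
              (∀ S → Shatters F S → ∣ S ∣ < d) → length F ≤ Ψ m d
sauerShelah m zero [] _ _ = z≤n
sauerShelah m zero (x ∷ F) _ small
  with () ← small ⊥ (λ σ → x , here refl , trans (∩-zeroˡ x) (sym (∩-zeroˡ σ)))
sauerShelah zero (suc d) []            _                 _ = z≤n
sauerShelah zero (suc d) ([] ∷ [])     _                 _ = s≤s z≤n
sauerShelah zero (suc d) ([] ∷ [] ∷ F) ((distinct ∷ _) ∷ _) _ = ⊥-elim (distinct refl)
sauerShelah (suc m) (suc d) F uniqF small = begin
  length F                                ≡⟨ length-withHead F ⟩
  length F₀ + length F₁                   ≡⟨ cong (length F₀ +_) (length-filter-split (_∈? F₀) F₁) ⟩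
  length F₀ + (length F₀₁ + length F₁₋₀)  ≡⟨ reorder (length F₀) (length F₀₁) (length F₁₋₀) ⟩
  length F₀ + length F₁₋₀ + length F₀₁    ≡⟨ cong (_+ length F₀₁) (length-++ F₀) ⟨
  length F₀∪₁ + length F₀₁
    ≤⟨ +-mono-≤ (sauerShelah m (suc d) F₀∪₁ unique₀∪₁ small₀∪₁) (sauerShelah m d F₀₁ unique₀₁ small₀₁) ⟩
  Ψ m (suc d) + Ψ m d                     ∎
  where
  open ≤-Reasoning
  open DecMembership (Vec.≡-dec {n = m} _≟_) using (_∈?_)
  F₀ F₁ F₀₁ F₁₋₀ F₀∪₁ : List (Subset m)
  F₀    = withHead false F
  F₁    = withHead true F
  F₀₁   = filter (_∈? F₀) F₁
  F₁₋₀  = filter (¬? ∘ (_∈? F₀)) F₁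
  F₀∪₁ = F₀ ++ F₁₋₀

  reorder : ∀ a b c → a + (b + c) ≡ a + c + b
  reorder = solve-∀

  unique₀∪₁ : Unique F₀∪₁
  unique₀∪₁ = Unique.++⁺ (withHead-unique false F uniqF)
                         (Unique.filter⁺ _ (withHead-unique true F uniqF))
                λ (y∈F₀ , y∈F₁₋₀) → proj₂ (∈-filter⁻ (¬? ∘ (_∈? F₀)) {xs = F₁} y∈F₁₋₀) y∈F₀
  unique₀₁ : Unique F₀₁
  unique₀₁ = Unique.filter⁺ _ (withHead-unique true F uniqF)

  extend : ∀ {y} → y ∈ F₀∪₁ → ∃[ b ] (b ∷ y) ∈ F
  extend y∈ with ∈-++⁻ F₀ y∈
  ... | inj₁ y∈F₀   = false , ∈-withHead false F y∈F₀
  ... | inj₂ y∈F₁₋₀ = true , ∈-withHead true F (proj₁ (∈-filter⁻ (¬? ∘ (_∈? F₀)) {xs = F₁} y∈F₁₋₀))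

  small₀∪₁ : ∀ S → Shatters F₀∪₁ S → ∣ S ∣ < suc d
  small₀∪₁ S shatters = small (false ∷ S) λ where
    (b ∷ σ) → let (y , y∈ , trace) = shatters σ in
              (proj₁ (extend y∈) ∷ y) , proj₂ (extend y∈) , cong (false ∷_) trace

  small₀₁ : ∀ S → Shatters F₀₁ S → ∣ S ∣ < d
  small₀₁ S shatters = ≤-pred (small (true ∷ S) λ where
    (b ∷ σ) → let (y , y∈ , trace) = shatters σ
                  (y∈F₁ , y∈F₀) = ∈-filter⁻ (_∈? F₀) {xs = F₁} y∈ in
              (b ∷ y) , both b y∈F₀ y∈F₁ , cong (b ∷_) trace)
    where
    both : ∀ b {y} → y ∈ F₀ → y ∈ F₁ → (b ∷ y) ∈ F
    both false y∈F₀ _ = ∈-withHead false F y∈F₀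
    both true  _ y∈F₁ = ∈-withHead true F y∈F₁

module _ {A : Set} {k} (Q : Fin k → List A) (F : List A) (meets : ∀ i → Any (_∈ F) (Q i)) where

  private
    witness : Fin k → A
    witness i = proj₁ (find (meets i))
    witness∈Q : ∀ i → witness i ∈ Q i
    witness∈Q i = proj₁ (proj₂ (find (meets i)))
    witness∈F : ∀ i → witness i ∈ F
    witness∈F i = proj₂ (proj₂ (find (meets i)))

  sharedMember : length F < k → ∃[ i ] ∃[ j ] i ≢ j × ∃[ x ] x ∈ Q i × x ∈ Q j
  sharedMember |F|<k with pigeonhole |F|<k (Any.index ∘ witness∈F)
  ... | i , j , i<j , samePosition =
    i , j , <⇒≢ i<j , witness i , witness∈Q i , subst (_∈ Q j) (sym sameWitness) (witness∈Q j)
    where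
    sameWitness : witness i ≡ witness j
    sameWitness = trans (lookup-index (witness∈F i))
                    (trans (cong (List.lookup F) samePosition) (sym (lookup-index (witness∈F j))))

module _ {A : Set} (_≟_ : DecidableEquality A) where
  open DecMembership _≟_ using (_∈?_)

  avoidingMember : ∀ {k} (Q : Fin k → List A) → (∀ i j → i ≢ j → ∀ x → x ∈ Q i → x ∉ Q j) →
                   (F : List A) → length F < k → ∃[ i ] (∀ x → x ∈ Q i → x ∉ F)
  avoidingMember Q disjoint F |F|<k with Fin.all? (λ i → Any.any? (_∈? F) (Q i))
  ... | yes meets with sharedMember Q F meets |F|<k
  ...   | i , j , i≢j , x , x∈Qi , x∈Qj = ⊥-elim (disjoint i j i≢j x x∈Qi x∈Qj)
  avoidingMember Q disjoint F |F|<k | no ¬meets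
    with Fin.¬∀⟶∃¬ _ _ (λ i → Any.any? (_∈? F) (Q i)) ¬meets
  ... | i , ¬meet = i , λ x x∈Qi x∈F → ¬meet (lose x∈Qi x∈F)

X⊂X∪⁅b⁆ : ∀ {k} {X : Subset k} {b} → b ∉ₛ X → X ⊂ X ∪ ⁅ b ⁆
X⊂X∪⁅b⁆ {X = X} {b} b∉X = p⊆p∪q ⁅ b ⁆ , b , q⊆p∪q X ⁅ b ⁆ (x∈⁅x⁆ b) , b∉X

module Reachability (G : Graph) {E : Fin (m G) → Set} (E? : Decidable E) where

  ClosedUnderEdges : Subset (n G) → Set
  ClosedUnderEdges X = ∀ {e a b} → E e → Joins G e a b → a ∈ₛ X → b ∈ₛ X

  private
    Leaves : Subset (n G) → Fin (m G) → Set
    Leaves X e = E e × let (a , b) = ends G e in (a ∈ₛ X × b ∉ₛ X) ⊎ (b ∈ₛ X × a ∉ₛ X)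

    leaves? : ∀ X → Decidable (Leaves X)
    leaves? X e = E? e ×-dec (((a ∈ₛ? X) ×-dec ¬? (b ∈ₛ? X)) ⊎-dec ((b ∈ₛ? X) ×-dec ¬? (a ∈ₛ? X)))
      where
      a = proj₁ (ends G e)
      b = proj₂ (ends G e)

    leaves : ∀ {X e a b} → E e → Joins G e a b → a ∈ₛ X → b ∉ₛ X → Leaves X e
    leaves Ee (inj₁ refl) a∈X b∉X = Ee , inj₁ (a∈X , b∉X)
    leaves Ee (inj₂ refl) a∈X b∉X = Ee , inj₂ (a∈X , b∉X)

    newVertex : ∀ {X e} → Leaves X e → ∃[ b ] b ∉ₛ X × ∃[ a ] a ∈ₛ X × Joins G e b a
    newVertex (_ , inj₁ (a∈X , b∉X)) = _ , b∉X , _ , a∈X , inj₂ refl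
    newVertex (_ , inj₂ (b∈X , a∉X)) = _ , a∉X , _ , b∈X , inj₁ refl

  reachingSet : ∀ v → Σ[ X ∈ Subset (n G) ]
                  v ∈ₛ X × ClosedUnderEdges X × (∀ {w} → w ∈ₛ X → Walk G E w v)
  reachingSet v = grow (n G) ⁅ v ⁆ (m≤m+n (n G) ∣ ⁅ v ⁆ ∣) (x∈⁅x⁆ v)
                    λ w∈⁅v⁆ → subst (λ w → Walk G E w v) (sym (x∈⁅y⁆⇒x≡y v w∈⁅v⁆)) here
    where
    grow : ∀ fuel X → n G ≤ fuel + ∣ X ∣ → v ∈ₛ X → (∀ {w} → w ∈ₛ X → Walk G E w v) →
           Σ[ Y ∈ Subset (n G) ] v ∈ₛ Y × ClosedUnderEdges Y × (∀ {w} → w ∈ₛ Y → Walk G E w v)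
    grow fuel X bound v∈X walk with any? (leaves? X)
    ... | no noneLeaves = X , v∈X , closed , walk
      where
      closed : ClosedUnderEdges X
      closed {b = b} Ee joins a∈X with b ∈ₛ? X
      ... | yes b∈X = b∈X
      ... | no  b∉X = ⊥-elim (noneLeaves (_ , leaves Ee joins a∈X b∉X))
    ... | yes (e , leavesX@(Ee , _)) with newVertex leavesX | fuel
    ...   | b , b∉X , _ , _ , _ | zero =
      ⊥-elim (<⇒≱ (<-≤-trans (p⊂q⇒∣p∣<∣q∣ (X⊂X∪⁅b⁆ b∉X)) (∣p∣≤n (X ∪ ⁅ b ⁆))) bound)
    ...   | b , b∉X , a , a∈X , joins | suc fuel′ =
      grow fuel′ (X ∪ ⁅ b ⁆) bound′ (p⊆p∪q ⁅ b ⁆ v∈X) walk′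
      where
      bound′ : n G ≤ fuel′ + ∣ X ∪ ⁅ b ⁆ ∣
      bound′ = ≤-trans bound (≤-trans (≤-reflexive (sym (+-suc fuel′ ∣ X ∣)))
                                      (+-monoʳ-≤ fuel′ (p⊂q⇒∣p∣<∣q∣ (X⊂X∪⁅b⁆ b∉X))))
      walk′ : ∀ {w} → w ∈ₛ X ∪ ⁅ b ⁆ → Walk G E w v
      walk′ w∈ with x∈p∪q⁻ X ⁅ b ⁆ w∈
      ... | inj₁ w∈X   = walk w∈X
      ... | inj₂ w∈⁅b⁆ =
        subst (λ w → Walk G E w v) (sym (x∈⁅y⁆⇒x≡y b w∈⁅b⁆)) (step e Ee joins (walk a∈X))

module _ (G : Graph) where

  joins-head-tail : ∀ (o : Orientation G) e → Joins G e (head G o e) (tail G o e)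
  joins-head-tail o e with lookup o e
  ... | true  = inj₂ refl
  ... | false = inj₁ refl

  orientOutOf : Subset (n G) → Orientation G
  orientOutOf X = tabulate λ e → does (proj₁ (ends G e) ∈ₛ? X)

  orientOutOf-noEntry : ∀ X (o : Orientation G) e → lookup o e ≡ lookup (orientOutOf X) e →
                        head G o e ∈ₛ X → tail G o e ∈ₛ X
  orientOutOf-noEntry X o e agrees head∈X
    with lookup o e | proj₁ (ends G e) ∈ₛ? X | trans agrees (Vec.lookup∘tabulate _ e)
  ... | true  | yes a∈X | _ = a∈X
  ... | false | no  a∉X | _ = ⊥-elim (a∉X head∈X)

  KeptEdge : Subset (m G) → List (Fin (m G)) → Fin (m G) → Set
  KeptEdge T F e = lookup T e ≡ true × e ∉ F

  keptEdge? : ∀ T F → Decidable (KeptEdge T F)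
  keptEdge? T F e = (lookup T e ≟ true) ×-dec ¬? (e ∈? F)
    where open DecMembership Fin._≟_ using (_∈?_)

  shattered⇒∁-kEdgeConnected : ∀ {k L} → All (ArcStrong G k) L → ∀ {S} → Shatters L S →
                              KEdgeConnectedSub G k (lookup (∁ S))
  shattered⇒∁-kEdgeConnected arcStrong {S} shatters F |F|<k u v
    with Reachability.reachingSet G (keptEdge? (∁ S) F) v
  ... | X , v∈X , closed , walk with shatters (orientOutOf X)
  ... | o , o∈L , trace with All.lookup arcStrong o∈L u v
  ... | P , _ , disjoint with avoidingMember Fin._≟_ (arcs G ∘ P) disjoint F |F|<k
  ... | i , avoidsF = walk (backwards (P i) avoidsF v∈X)
    where
    tail∈X : ∀ e → e ∉ F → head G o e ∈ₛ X → tail G o e ∈ₛ X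
    tail∈X e e∉F head∈X with lookup S e in e∈S
    ... | false =
      closed (trans (Vec.lookup-map e not S) (cong not e∈S) , e∉F) (joins-head-tail o e) head∈X
    ... | true  = orientOutOf-noEntry X o e (∩-agree-lookup trace e∈S) head∈X
    backwards : ∀ {w z} (p : DWalk G o w z) → (∀ e → e ∈ arcs G p → e ∉ F) → z ∈ₛ X → w ∈ₛ X
    backwards here           _      z∈X = z∈X
    backwards (step e refl p) avoids z∈X =
      tail∈X e (avoids e (here refl)) (backwards p (λ e′ → avoids e′ ∘ there) z∈X)

count-lookup : ∀ G {j} (p : Subset j) → count G (lookup p) ≡ ∣ p ∣
count-lookup G []          = refl
count-lookup G (true ∷ p)  = cong suc (count-lookup G p)
count-lookup G (false ∷ p) = count-lookup G p

proposition3p12 : (G : Graph) (k c : ℕ) →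
    KEdgeConnected G k →
    IsMinKECSize G k c →
    c < m G →
    NumArcStrongSatisfies G k (AtMostMeOverDPowD (m G) (m G ∸ c))
proposition3p12 G k c _ (_ , minimal) c<m L unique arcStrong =
  AtMostMeOverDPowD-antimono (sauerShelah (m G) (suc (m G ∸ c)) L unique shattered-small)
    (Ψ-atMostMeOverDPowD (m G) (m G ∸ c) (m<n⇒0<n∸m c<m) (m∸n≤m (m G) c))
  where
  shattered-small : ∀ S → Shatters L S → ∣ S ∣ < suc (m G ∸ c)
  shattered-small S shatters = s≤s (begin
    ∣ S ∣                 ≡⟨ m∸[m∸n]≡n (∣p∣≤n S) ⟨
    m G ∸ (m G ∸ ∣ S ∣)   ≡⟨ cong (m G ∸_) (∣∁p∣≡n∸∣p∣ S) ⟨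
    m G ∸ ∣ ∁ S ∣         ≤⟨ ∸-monoʳ-≤ (m G) c≤∣∁S∣ ⟩
    m G ∸ c               ∎)
    where
    open ≤-Reasoning
    c≤∣∁S∣ : c ≤ ∣ ∁ S ∣
    c≤∣∁S∣ = subst (c ≤_) (count-lookup G (∁ S))
               (minimal (lookup (∁ S)) (shattered⇒∁-kEdgeConnected G arcStrong shatters))
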